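{- Let $\sigma=\{*\mid\cdot\}$ and $\mathsf{L}(\sigma)=\{\sigma\mid\cdot\}$. Then the misère monoid $\mathcal{M}_{\mathrm{cl}(\mathsf{L}(\sigma))}$ is infinite.
   Context: A position $\xi=\{\xi^L \mid \xi^R\}$ is given recursively by finite sets of Left and Right options; $\cdot$ denotes an empty set. $0=\{\cdot\mid\cdot\}$, $*=\{0\mid0\}$. Disjunctive sum: $\alpha+\beta=\{\alpha^L+\beta,\alpha+\beta^L \mid \alpha^R+\beta,\alpha+\beta^R\}$. Under misère play a player unable to move on their turn wins; $o^-$ denotes misère outcome ($\mathcal{L}$, $\mathcal{R}$, $\mathcal{N}$ next player wins, $\mathcal{P}$ next player loses). $\mathrm{cl}(\xi)$ is the smallest set containing $\xi$ closed under disjunctive sum and taking options. For closed $\Gamma$, $\alpha\equiv\beta\pmod\Gamma$ iff $o^-(\alpha+\gamma)=o^-(\beta+\gamma)$ for all $\gamma\in\Gamma$; the misère monoid $\mathcal{M}_\Gamma$ is the set of $\equiv$-classes with the monoid operation induced by disjunctive sum. -}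

module Defs where

open import Data.Nat using (ℕ)
open import Data.Bool using (Bool; true; false; _∨_; _∧_; not)
open import Data.List using (List; []; _∷_; _++_)
open import Data.List.Membership.Propositional using (_∈_)
open import Data.Product using (Σ; ∃; _×_; _,_)
open import Relation.Binary.PropositionalEquality using (_≡_; _≢_)
open import Relation.Nullary using (¬_)

data Game : Set where
  ⟨_∣_⟩ : List Game → List Game → Game

leftOpts : Game → List Game
leftOpts ⟨ L ∣ R ⟩ = L

rightOpts : Game → List Game
rightOpts ⟨ L ∣ R ⟩ = R

𝟘 : Game
𝟘 = ⟨ [] ∣ [] ⟩

⋆ : Game
⋆ = ⟨ 𝟘 ∷ [] ∣ 𝟘 ∷ [] ⟩

σ : Game
σ = ⟨ ⋆ ∷ [] ∣ [] ⟩

Lσ : Game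
Lσ = ⟨ σ ∷ [] ∣ [] ⟩

mutual
  infixl 6 _⊕_
  _⊕_ : Game → Game → Game
  ⟨ L₁ ∣ R₁ ⟩ ⊕ ⟨ L₂ ∣ R₂ ⟩ =
    ⟨ addʳ L₁ ⟨ L₂ ∣ R₂ ⟩ ++ addˡ ⟨ L₁ ∣ R₁ ⟩ L₂
    ∣ addʳ R₁ ⟨ L₂ ∣ R₂ ⟩ ++ addˡ ⟨ L₁ ∣ R₁ ⟩ R₂ ⟩

  addʳ : List Game → Game → List Game
  addʳ [] h = []
  addʳ (x ∷ xs) h = (x ⊕ h) ∷ addʳ xs h

  addˡ : Game → List Game → List Game
  addˡ g [] = []
  addˡ g (y ∷ ys) = (g ⊕ y) ∷ addˡ g ys

null : List Game → Bool
null [] = true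
null (_ ∷ _) = false

-- Misère play: a player unable to move on their turn wins.
-- leftFirst g  : Left wins moving first;  leftSecond g : Left wins when Right moves first.
-- rightFirst g : Right wins moving first; rightSecond g : Right wins when Left moves first.
mutual
  leftFirst : Game → Bool
  leftFirst ⟨ L ∣ R ⟩ = null L ∨ anyLeftSecond L

  leftSecond : Game → Bool
  leftSecond ⟨ L ∣ R ⟩ = not (null R) ∧ allLeftFirst R

  anyLeftSecond : List Game → Bool
  anyLeftSecond [] = false
  anyLeftSecond (x ∷ xs) = leftSecond x ∨ anyLeftSecond xs

  allLeftFirst : List Game → Bool
  allLeftFirst [] = true
  allLeftFirst (x ∷ xs) = leftFirst x ∧ allLeftFirst xs

mutual
  rightFirst : Game → Bool
  rightFirst ⟨ L ∣ R ⟩ = null R ∨ anyRightSecond R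

  rightSecond : Game → Bool
  rightSecond ⟨ L ∣ R ⟩ = not (null L) ∧ allRightFirst L

  anyRightSecond : List Game → Bool
  anyRightSecond [] = false
  anyRightSecond (x ∷ xs) = rightSecond x ∨ anyRightSecond xs

  allRightFirst : List Game → Bool
  allRightFirst [] = true
  allRightFirst (x ∷ xs) = rightFirst x ∧ allRightFirst xs

data Outcome : Set where
  𝓛 𝓡 𝓝 𝓟 : Outcome

classify : Bool → Bool → Outcome
classify true  true  = 𝓝
classify true  false = 𝓛
classify false true  = 𝓡
classify false false = 𝓟

o⁻ : Game → Outcome
o⁻ g = classify (leftFirst g) (rightFirst g)

data Cl (ξ : Game) : Game → Set where
  base : Cl ξ ξ
  sum  : ∀ {α β} → Cl ξ α → Cl ξ β → Cl ξ (α ⊕ β)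
  optL : ∀ {α α'} → Cl ξ α → α' ∈ leftOpts α → Cl ξ α'
  optR : ∀ {α α'} → Cl ξ α → α' ∈ rightOpts α → Cl ξ α'

_≡[_]_ : Game → (Game → Set) → Game → Set
α ≡[ Γ ] β = ∀ γ → Γ γ → o⁻ (α ⊕ γ) ≡ o⁻ (β ⊕ γ)

-- The misère monoid M_Γ is infinite: there are infinitely many pairwise
-- inequivalent elements of Γ (an injection ℕ → M_Γ).
MonoidInfinite : (Game → Set) → Set
MonoidInfinite Γ =
  Σ (ℕ → Game) λ f → (∀ n → Γ (f n)) × (∀ m n → m ≢ n → ¬ (f m ≡[ Γ ] f n))

module Submission where

-- The misère monoid of cl(L(σ)) is infinite because the games n·L(σ) are
-- pairwise distinguished by the games m·⋆ of the same closure.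
--
-- Every sum of copies of L(σ), σ, ⋆ and 𝟘 lies in cl(L(σ)); such sums are
-- represented by syntax trees (Pos).  Left's moves in a tree demote an L(σ)
-- to σ, promote a σ to ⋆, or clear a ⋆ to 𝟘; Right can only clear a ⋆.
-- Writing a for the number of L(σ) and c for the number of ⋆ (σ does not
-- count), the key fact is the misère analysis
--     Left wins moving first       ⇔  c = a + 2k for some k,
--     Left wins when Right starts  ⇔  c = (a + 1) + 2k for some k,
-- proved by simultaneous induction on the rank (3·#L(σ) + 2·#σ + #⋆),
-- which every move lowers by exactly one.  For m < n, Left moving first
-- therefore wins m·L(σ) + m·⋆ but loses n·L(σ) + m·⋆, so m·L(σ) and
-- n·L(σ) have different misère outcomes against m·⋆.

open import Defs
open import Data.Nat using (ℕ; zero; suc; _+_; _<_; s≤s)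
open import Data.Nat.Properties using (+-suc; +-identityʳ; suc-injective; <-cmp)
open import Data.Bool using (Bool; true; false)
open import Data.Bool.Properties using (∧-identityʳ; ∧-idem)
open import Data.Empty using (⊥; ⊥-elim)
open import Data.List using (List; []; _∷_; _++_; map)
open import Data.List.Membership.Propositional using (_∈_)
open import Data.List.Membership.Propositional.Properties using (∈-map⁺; ∈-map⁻; ∈-++⁺ˡ; ∈-++⁺ʳ; ∈-++⁻)
open import Data.List.Relation.Unary.Any using (here; there)
open import Data.Product using (∃; ∃₂; _×_; _,_; proj₁; proj₂)
open import Data.Sum using (_⊎_; inj₁; inj₂)
open import Relation.Binary using (tri<; tri≈; tri>)
open import Relation.Binary.PropositionalEquality using (_≡_; _≢_; refl; sym; trans; cong; cong₂; module ≡-Reasoning)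
open import Relation.Nullary using (¬_)

leftFirst-winningOption : ∀ g {g'} → g' ∈ leftOpts g → leftSecond g' ≡ true → leftFirst g ≡ true
leftFirst-winningOption ⟨ x ∷ L ∣ R ⟩ = some (x ∷ L)
  where
  some : ∀ L {g'} → g' ∈ L → leftSecond g' ≡ true → anyLeftSecond L ≡ true
  some (x ∷ xs) (here refl) w rewrite w = refl
  some (x ∷ xs) (there m) w with leftSecond x
  ... | true = refl
  ... | false = some xs m w

leftFirst-allWinning : ∀ g → (∀ {g'} → g' ∈ leftOpts g → leftSecond g' ≡ true) → leftFirst g ≡ true
leftFirst-allWinning ⟨ [] ∣ R ⟩ w = refl
leftFirst-allWinning ⟨ x ∷ L ∣ R ⟩ w = leftFirst-winningOption ⟨ x ∷ L ∣ R ⟩ (here refl) (w (here refl))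

leftFirst-allLosing : ∀ g {g₀} → g₀ ∈ leftOpts g → (∀ {g'} → g' ∈ leftOpts g → leftSecond g' ≡ false) → leftFirst g ≡ false
leftFirst-allLosing ⟨ x ∷ L ∣ R ⟩ _ l = none (x ∷ L) l
  where
  none : ∀ L → (∀ {g'} → g' ∈ L → leftSecond g' ≡ false) → anyLeftSecond L ≡ false
  none [] l = refl
  none (x ∷ xs) l rewrite l (here refl) = none xs (λ m → l (there m))

leftSecond-noOption : ∀ g → (∀ {r} → r ∈ rightOpts g → ⊥) → leftSecond g ≡ false
leftSecond-noOption ⟨ L ∣ [] ⟩ n = refl
leftSecond-noOption ⟨ L ∣ x ∷ R ⟩ n = ⊥-elim (n (here refl))

leftSecond-uniform : ∀ g {r₀} b → r₀ ∈ rightOpts g → (∀ {r} → r ∈ rightOpts g → leftFirst r ≡ b) → leftSecond g ≡ b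
leftSecond-uniform ⟨ L ∣ x ∷ R ⟩ b _ u = every x R u
  where
  every : ∀ x R → (∀ {r} → r ∈ x ∷ R → leftFirst r ≡ b) → allLeftFirst (x ∷ R) ≡ b
  every x [] u rewrite u (here refl) = ∧-identityʳ b
  every x (y ∷ R) u rewrite u (here refl) | every y R (λ m → u (there m)) = ∧-idem b

-- The options of either player, so that sums are treated once for both sides.
data Side : Set where
  left right : Side

opts : Side → Game → List Game
opts left = leftOpts
opts right = rightOpts

addʳ-map : ∀ xs h → addʳ xs h ≡ map (_⊕ h) xs
addʳ-map [] h = refl
addʳ-map (x ∷ xs) h = cong (x ⊕ h ∷_) (addʳ-map xs h)

addˡ-map : ∀ g ys → addˡ g ys ≡ map (g ⊕_) ys
addˡ-map g [] = refl
addˡ-map g (y ∷ ys) = cong (g ⊕ y ∷_) (addˡ-map g ys)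

opts-⊕ : ∀ p x y → opts p (x ⊕ y) ≡ map (_⊕ y) (opts p x) ++ map (x ⊕_) (opts p y)
opts-⊕ left  ⟨ L₁ ∣ R₁ ⟩ y@(⟨ L₂ ∣ R₂ ⟩) = cong₂ _++_ (addʳ-map L₁ y) (addˡ-map ⟨ L₁ ∣ R₁ ⟩ L₂)
opts-⊕ right ⟨ L₁ ∣ R₁ ⟩ y@(⟨ L₂ ∣ R₂ ⟩) = cong₂ _++_ (addʳ-map R₁ y) (addˡ-map ⟨ L₁ ∣ R₁ ⟩ R₂)

-- Sums of L(σ), σ, ⋆ and 𝟘

infixl 6 _⊞_
infix 4 _⊢_⟶[_]_

data Pos : Set where
  [Lσ] [σ] [⋆] [𝟘] : Pos
  _⊞_ : Pos → Pos → Pos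

⟦_⟧ : Pos → Game
⟦ [Lσ] ⟧ = Lσ
⟦ [σ] ⟧ = σ
⟦ [⋆] ⟧ = ⋆
⟦ [𝟘] ⟧ = 𝟘
⟦ s ⊞ u ⟧ = ⟦ s ⟧ ⊕ ⟦ u ⟧

-- Every such sum lies in cl(L(σ)): σ, ⋆ and 𝟘 are iterated Left options of L(σ).
inClosure : ∀ t → Cl Lσ ⟦ t ⟧
inClosure [Lσ] = base
inClosure [σ] = optL base (here refl)
inClosure [⋆] = optL (optL base (here refl)) (here refl)
inClosure [𝟘] = optL (optL (optL base (here refl)) (here refl)) (here refl)
inClosure (s ⊞ u) = sum (inClosure s) (inClosure u)

-- #L(σ), #⋆, and the rank 3·#L(σ) + 2·#σ + #⋆ (the number of moves left).
#Lσ #⋆ rank : Pos → ℕ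
#Lσ [Lσ] = 1
#Lσ (s ⊞ u) = #Lσ s + #Lσ u
#Lσ _ = 0
#⋆ [⋆] = 1
#⋆ (s ⊞ u) = #⋆ s + #⋆ u
#⋆ _ = 0
rank [Lσ] = 3
rank [σ] = 2
rank [⋆] = 1
rank [𝟘] = 0
rank (s ⊞ u) = rank s + rank u

data Kind : Set where
  demotion promotion clearing : Kind

data _⊢_⟶[_]_ : Side → Pos → Kind → Pos → Set where
  demote  : left ⊢ [Lσ] ⟶[ demotion ] [σ]
  promote : left ⊢ [σ] ⟶[ promotion ] [⋆]
  clear   : ∀ {p} → p ⊢ [⋆] ⟶[ clearing ] [𝟘]
  inˡ     : ∀ {p k s s'} u → p ⊢ s ⟶[ k ] s' → p ⊢ s ⊞ u ⟶[ k ] s' ⊞ u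
  inʳ     : ∀ {p k u u'} s → p ⊢ u ⟶[ k ] u' → p ⊢ s ⊞ u ⟶[ k ] s ⊞ u'

move-sound : ∀ {p k t t'} → p ⊢ t ⟶[ k ] t' → ⟦ t' ⟧ ∈ opts p ⟦ t ⟧
move-sound demote = here refl
move-sound promote = here refl
move-sound {left} clear = here refl
move-sound {right} clear = here refl
move-sound {p} (inˡ {s = s} u m) rewrite opts-⊕ p ⟦ s ⟧ ⟦ u ⟧ = ∈-++⁺ˡ (∈-map⁺ (_⊕ ⟦ u ⟧) (move-sound m))
move-sound {p} (inʳ {u = u} s m) rewrite opts-⊕ p ⟦ s ⟧ ⟦ u ⟧ = ∈-++⁺ʳ _ (∈-map⁺ (⟦ s ⟧ ⊕_) (move-sound m))

move-complete : ∀ p t {g} → g ∈ opts p ⟦ t ⟧ → ∃₂ λ k t' → p ⊢ t ⟶[ k ] t' × g ≡ ⟦ t' ⟧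
move-complete left [Lσ] (here refl) = _ , _ , demote , refl
move-complete left [σ] (here refl) = _ , _ , promote , refl
move-complete left [⋆] (here refl) = _ , _ , clear , refl
move-complete right [⋆] (here refl) = _ , _ , clear , refl
move-complete left [𝟘] ()
move-complete right [Lσ] ()
move-complete right [σ] ()
move-complete right [𝟘] ()
move-complete p (s ⊞ u) g∈ rewrite opts-⊕ p ⟦ s ⟧ ⟦ u ⟧ with ∈-++⁻ _ g∈
... | inj₁ g∈ˡ with ∈-map⁻ (_⊕ ⟦ u ⟧) g∈ˡ
...   | x , x∈ , refl with move-complete p s x∈
...     | k , s' , m , refl = k , s' ⊞ u , inˡ u m , refl
move-complete p (s ⊞ u) g∈ | inj₂ g∈ʳ with ∈-map⁻ (⟦ s ⟧ ⊕_) g∈ʳ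
...   | y , y∈ , refl with move-complete p u y∈
...     | k , u' , m , refl = k , s ⊞ u' , inʳ s m , refl

rank-step : ∀ {p k t t'} → p ⊢ t ⟶[ k ] t' → rank t ≡ suc (rank t')
rank-step demote = refl
rank-step promote = refl
rank-step clear = refl
rank-step (inˡ u m) = cong (_+ rank u) (rank-step m)
rank-step (inʳ {u' = u'} s m) = trans (cong (rank s +_) (rank-step m)) (+-suc (rank s) (rank u'))

Effect : Kind → Pos → Pos → Set
Effect demotion  t t' = #Lσ t ≡ suc (#Lσ t') × #⋆ t' ≡ #⋆ t
Effect promotion t t' = #Lσ t' ≡ #Lσ t × #⋆ t' ≡ suc (#⋆ t)
Effect clearing  t t' = #Lσ t' ≡ #Lσ t × #⋆ t ≡ suc (#⋆ t')

effect-inˡ : ∀ k u {s s'} → Effect k s s' → Effect k (s ⊞ u) (s' ⊞ u)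
effect-inˡ demotion  u (eL , e⋆) = cong (_+ #Lσ u) eL , cong (_+ #⋆ u) e⋆
effect-inˡ promotion u (eL , e⋆) = cong (_+ #Lσ u) eL , cong (_+ #⋆ u) e⋆
effect-inˡ clearing  u (eL , e⋆) = cong (_+ #Lσ u) eL , cong (_+ #⋆ u) e⋆

effect-inʳ : ∀ k s {u u'} → Effect k u u' → Effect k (s ⊞ u) (s ⊞ u')
effect-inʳ demotion  s {u' = u'} (eL , e⋆) = trans (cong (#Lσ s +_) eL) (+-suc (#Lσ s) (#Lσ u')) , cong (#⋆ s +_) e⋆
effect-inʳ promotion s {u = u}   (eL , e⋆) = cong (#Lσ s +_) eL , trans (cong (#⋆ s +_) e⋆) (+-suc (#⋆ s) (#⋆ u))
effect-inʳ clearing  s {u' = u'} (eL , e⋆) = cong (#Lσ s +_) eL , trans (cong (#⋆ s +_) e⋆) (+-suc (#⋆ s) (#⋆ u'))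

effect : ∀ {p k t t'} → p ⊢ t ⟶[ k ] t' → Effect k t t'
effect demote = refl , refl
effect promote = refl , refl
effect clear = refl , refl
effect {k = k} (inˡ u m) = effect-inˡ k u (effect m)
effect {k = k} (inʳ s m) = effect-inʳ k s (effect m)

right-clears : ∀ {k t t'} → right ⊢ t ⟶[ k ] t' → k ≡ clearing
right-clears clear = refl
right-clears (inˡ u m) = right-clears m
right-clears (inʳ s m) = right-clears m

demotion? : ∀ t → (∃ λ t' → left ⊢ t ⟶[ demotion ] t') ⊎ #Lσ t ≡ 0
demotion? [Lσ] = inj₁ (_ , demote)
demotion? [σ] = inj₂ refl
demotion? [⋆] = inj₂ refl
demotion? [𝟘] = inj₂ refl
demotion? (s ⊞ u) with demotion? s | demotion? u
... | inj₁ (s' , m) | _ = inj₁ (s' ⊞ u , inˡ u m)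
... | inj₂ _ | inj₁ (u' , m) = inj₁ (s ⊞ u' , inʳ s m)
... | inj₂ zs | inj₂ zu = inj₂ (cong₂ _+_ zs zu)

clearing? : ∀ p t → (∃ λ t' → p ⊢ t ⟶[ clearing ] t') ⊎ #⋆ t ≡ 0
clearing? p [Lσ] = inj₂ refl
clearing? p [σ] = inj₂ refl
clearing? p [⋆] = inj₁ (_ , clear)
clearing? p [𝟘] = inj₂ refl
clearing? p (s ⊞ u) with clearing? p s | clearing? p u
... | inj₁ (s' , m) | _ = inj₁ (s' ⊞ u , inˡ u m)
... | inj₂ _ | inj₁ (u' , m) = inj₁ (s ⊞ u' , inʳ s m)
... | inj₂ zs | inj₂ zu = inj₂ (cong₂ _+_ zs zu)

no-demotion : ∀ {p t t'} → #Lσ t ≡ 0 → ¬ (p ⊢ t ⟶[ demotion ] t')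
no-demotion z m with trans (sym z) (proj₁ (effect m))
... | ()

no-clearing : ∀ {p t t'} → #⋆ t ≡ 0 → ¬ (p ⊢ t ⟶[ clearing ] t')
no-clearing z m with trans (sym z) (proj₂ (effect m))
... | ()

-- evenExcess a c = true  iff  c = a + 2k for some k.
evenExcess : ℕ → ℕ → Bool
evenExcess zero zero = true
evenExcess zero (suc zero) = false
evenExcess zero (suc (suc c)) = evenExcess zero c
evenExcess (suc a) zero = false
evenExcess (suc a) (suc c) = evenExcess a c

evenExcess-+2 : ∀ a c → evenExcess a c ≡ true → evenExcess a (suc (suc c)) ≡ true
evenExcess-+2 zero c e = e
evenExcess-+2 (suc a) (suc c) e = evenExcess-+2 a c e

-- Trading a ⋆ for an L(σ) cannot create the condition; needed when Left clears
-- a ⋆ from a losing position.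
evenExcess-shift : ∀ a c → evenExcess a (suc c) ≡ false → evenExcess (suc a) c ≡ false
evenExcess-shift a zero e = refl
evenExcess-shift a (suc c) e with evenExcess a c in e'
... | false = refl
... | true = trans (sym (evenExcess-+2 a c e')) e

-- Needed for Left clearing a ⋆ when no L(σ) is present.
evenExcess-clearFromZero : ∀ c → evenExcess 0 (suc c) ≡ true → evenExcess 1 c ≡ true
evenExcess-clearFromZero (suc c) e = e

evenExcess-refl : ∀ n → evenExcess n n ≡ true
evenExcess-refl zero = refl
evenExcess-refl (suc n) = evenExcess-refl n

evenExcess-deficit : ∀ {m n} → m < n → evenExcess n m ≡ false
evenExcess-deficit {zero} {suc n} _ = refl
evenExcess-deficit {suc m} {suc n} (s≤s m<n) = evenExcess-deficit m<n

-- The misère analysis of positions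

firstWin secondWin : Pos → Bool
firstWin t = evenExcess (#Lσ t) (#⋆ t)
secondWin t = evenExcess (suc (#Lσ t)) (#⋆ t)

secondWin-afterDemotion : ∀ {p t t'} → p ⊢ t ⟶[ demotion ] t' → secondWin t' ≡ firstWin t
secondWin-afterDemotion m with effect m
... | eL , e⋆ = cong₂ evenExcess (sym eL) e⋆

secondWin-afterPromotion : ∀ {p t t'} → p ⊢ t ⟶[ promotion ] t' → secondWin t' ≡ firstWin t
secondWin-afterPromotion m with effect m
... | eL , e⋆ rewrite e⋆ | eL = refl

firstWin-afterClearing : ∀ {p t t'} → p ⊢ t ⟶[ clearing ] t' → firstWin t' ≡ secondWin t
firstWin-afterClearing m with effect m
... | eL , e⋆ rewrite e⋆ | eL = refl

secondWin-afterClearing : ∀ {p t t'} → p ⊢ t ⟶[ clearing ] t' → firstWin t ≡ false → secondWin t' ≡ false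
secondWin-afterClearing {t' = t'} m e with effect m
... | eL , e⋆ = evenExcess-shift (#Lσ t') (#⋆ t') (trans (cong₂ evenExcess eL (sym e⋆)) e)

secondWin-afterClearing-noLσ : ∀ {p t t'} → p ⊢ t ⟶[ clearing ] t' → #Lσ t ≡ 0 → firstWin t ≡ true → secondWin t' ≡ true
secondWin-afterClearing-noLσ {t' = t'} m z e with effect m
... | eL , e⋆ rewrite eL | z | e⋆ = evenExcess-clearFromZero (#⋆ t') e

leftSecond-step : ∀ t → (∀ {k t'} → right ⊢ t ⟶[ k ] t' → leftFirst ⟦ t' ⟧ ≡ firstWin t') → leftSecond ⟦ t ⟧ ≡ secondWin t
leftSecond-step t ih with clearing? right t
... | inj₁ (_ , m₀) = leftSecond-uniform ⟦ t ⟧ (secondWin t) (move-sound m₀) afterMove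
  where
  afterMove : ∀ {r} → r ∈ rightOpts ⟦ t ⟧ → leftFirst r ≡ secondWin t
  afterMove r∈ with move-complete right t r∈
  ... | _ , _ , m , refl with right-clears m
  ...   | refl = trans (ih m) (firstWin-afterClearing m)
... | inj₂ no⋆ = trans (leftSecond-noOption ⟦ t ⟧ noMove) (sym (cong (evenExcess (suc (#Lσ t))) no⋆))
  where
  noMove : ∀ {r} → r ∈ rightOpts ⟦ t ⟧ → ⊥
  noMove r∈ with move-complete right t r∈
  ... | _ , _ , m , refl with right-clears m
  ...   | refl = no-clearing no⋆ m

LeftOptionsCorrect : Pos → Set
LeftOptionsCorrect t = ∀ {k t'} → left ⊢ t ⟶[ k ] t' → leftSecond ⟦ t' ⟧ ≡ secondWin t'

-- A winning first move for Left: demote if possible, else clear a ⋆; with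
-- neither L(σ) nor ⋆, every move (a promotion) wins.
leftFirst-winning : ∀ t → LeftOptionsCorrect t → firstWin t ≡ true → leftFirst ⟦ t ⟧ ≡ true
leftFirst-winning t ih e with demotion? t | clearing? left t
... | inj₁ (_ , m) | _ =
  leftFirst-winningOption ⟦ t ⟧ (move-sound m) (trans (ih m) (trans (secondWin-afterDemotion m) e))
... | inj₂ noLσ | inj₁ (_ , m) =
  leftFirst-winningOption ⟦ t ⟧ (move-sound m) (trans (ih m) (secondWin-afterClearing-noLσ m noLσ e))
... | inj₂ noLσ | inj₂ no⋆ = leftFirst-allWinning ⟦ t ⟧ promotionWins
  where
  promotionWins : ∀ {g} → g ∈ leftOpts ⟦ t ⟧ → leftSecond g ≡ true
  promotionWins g∈ with move-complete left t g∈
  ... | promotion , _ , m , refl = trans (ih m) (trans (secondWin-afterPromotion m) e)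
  ... | demotion , _ , m , refl = ⊥-elim (no-demotion noLσ m)
  ... | clearing , _ , m , refl = ⊥-elim (no-clearing no⋆ m)

-- A position where Left moving first loses is not terminal (terminal positions are misère wins).
leftMove-exists : ∀ t → firstWin t ≡ false → ∃₂ λ k t' → left ⊢ t ⟶[ k ] t'
leftMove-exists t e with demotion? t | clearing? left t
... | inj₁ (_ , m) | _ = _ , _ , m
... | inj₂ _ | inj₁ (_ , m) = _ , _ , m
... | inj₂ noLσ | inj₂ no⋆ with trans (sym (cong₂ evenExcess noLσ no⋆)) e
...   | ()

leftFirst-losing : ∀ t → LeftOptionsCorrect t → firstWin t ≡ false → leftFirst ⟦ t ⟧ ≡ false
leftFirst-losing t ih e =
  let _ , _ , m₀ = leftMove-exists t e in leftFirst-allLosing ⟦ t ⟧ (move-sound m₀) everyMoveLoses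
  where
  everyMoveLoses : ∀ {g} → g ∈ leftOpts ⟦ t ⟧ → leftSecond g ≡ false
  everyMoveLoses g∈ with move-complete left t g∈
  ... | demotion , _ , m , refl = trans (ih m) (trans (secondWin-afterDemotion m) e)
  ... | promotion , _ , m , refl = trans (ih m) (trans (secondWin-afterPromotion m) e)
  ... | clearing , _ , m , refl = trans (ih m) (secondWin-afterClearing m e)

leftFirst-step : ∀ t → LeftOptionsCorrect t → leftFirst ⟦ t ⟧ ≡ firstWin t
leftFirst-step t ih with firstWin t in e
... | true = leftFirst-winning t ih e
... | false = leftFirst-losing t ih e

Analysed : Pos → Set
Analysed t = leftFirst ⟦ t ⟧ ≡ firstWin t × leftSecond ⟦ t ⟧ ≡ secondWin t

-- Induction on the rank, which each move lowers by one.
analysis : ∀ t → Analysed t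
analysis t = byRank (rank t) t refl
  where
  byRank : ∀ n t → rank t ≡ n → Analysed t
  byRank n t rt = leftFirst-step t (λ m → proj₂ (next m)) , leftSecond-step t (λ m → proj₁ (next m))
    where
    below : ∀ n t' → n ≡ suc (rank t') → Analysed t'
    below (suc n) t' e = byRank n t' (sym (suc-injective e))

    next : ∀ {p k t'} → p ⊢ t ⟶[ k ] t' → Analysed t'
    next {t' = t'} m = below n t' (trans (sym rt) (rank-step m))

-- The distinguishing family

copies : Pos → ℕ → Pos
copies x zero = [𝟘]
copies x (suc n) = x ⊞ copies x n

counts-Lσs : ∀ n → #Lσ (copies [Lσ] n) ≡ n × #⋆ (copies [Lσ] n) ≡ 0
counts-Lσs zero = refl , refl
counts-Lσs (suc n) = let eL , e⋆ = counts-Lσs n in cong suc eL , e⋆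

counts-⋆s : ∀ m → #Lσ (copies [⋆] m) ≡ 0 × #⋆ (copies [⋆] m) ≡ m
counts-⋆s zero = refl , refl
counts-⋆s (suc m) = let eL , e⋆ = counts-⋆s m in eL , cong suc e⋆

leftFirst-test : ∀ n m → leftFirst (⟦ copies [Lσ] n ⟧ ⊕ ⟦ copies [⋆] m ⟧) ≡ evenExcess n m
leftFirst-test n m =
  let aL , a⋆ = counts-Lσs n ; bL , b⋆ = counts-⋆s m in
  trans (proj₁ (analysis (copies [Lσ] n ⊞ copies [⋆] m)))
        (cong₂ evenExcess (trans (cong₂ _+_ aL bL) (+-identityʳ n)) (cong₂ _+_ a⋆ b⋆))

leftWinsFirst : Outcome → Bool
leftWinsFirst 𝓛 = true
leftWinsFirst 𝓝 = true
leftWinsFirst 𝓡 = false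
leftWinsFirst 𝓟 = false

leftWinsFirst-o⁻ : ∀ g → leftWinsFirst (o⁻ g) ≡ leftFirst g
leftWinsFirst-o⁻ g with leftFirst g | rightFirst g
... | true  | true  = refl
... | true  | false = refl
... | false | true  = refl
... | false | false = refl

separated : ∀ {m n} → m < n → ¬ (⟦ copies [Lσ] m ⟧ ≡[ Cl Lσ ] ⟦ copies [Lσ] n ⟧)
separated {m} {n} m<n eq = true≢false (begin
  true                            ≡⟨ sym (evenExcess-refl m) ⟩
  evenExcess m m                  ≡⟨ sym (leftFirst-test m m) ⟩
  leftFirst (against m)           ≡⟨ sym (leftWinsFirst-o⁻ (against m)) ⟩
  leftWinsFirst (o⁻ (against m))  ≡⟨ cong leftWinsFirst (eq _ (inClosure (copies [⋆] m))) ⟩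
  leftWinsFirst (o⁻ (against n))  ≡⟨ leftWinsFirst-o⁻ (against n) ⟩
  leftFirst (against n)           ≡⟨ leftFirst-test n m ⟩
  evenExcess n m                  ≡⟨ evenExcess-deficit m<n ⟩
  false                           ∎)
  where
  open ≡-Reasoning
  against : ℕ → Game
  against k = ⟦ copies [Lσ] k ⟧ ⊕ ⟦ copies [⋆] m ⟧
  true≢false : true ≢ false
  true≢false ()

proposition3p3p3 : MonoidInfinite (Cl Lσ)
proposition3p3p3 = (λ n → ⟦ copies [Lσ] n ⟧) , (λ n → inClosure (copies [Lσ] n)) , distinct
  where
  distinct : ∀ m n → m ≢ n → ¬ (⟦ copies [Lσ] m ⟧ ≡[ Cl Lσ ] ⟦ copies [Lσ] n ⟧)
  distinct m n m≢n eq with <-cmp m n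
  ... | tri< m<n _ _ = separated m<n eq
  ... | tri≈ _ m≡n _ = m≢n m≡n
  ... | tri> _ _ n<m = separated n<m (λ γ γ∈ → sym (eq γ γ∈))
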